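{- Let $n\ge1$. The map $\mathsf{T}$ restricts to a bijection between the set of elements $w\in\mathcal{M}(A_{2n-1})$ whose level vector is antisymmetric (i.e. $\beta_i=-\beta_{2n+1-i}$ for all $1\le i\le n$) and the set of self-conjugate Shi tableaux of type $A_{2n-1}$ (equivalently, self-conjugate Shi tableaux of dominant alcoves of the Shi arrangement of type $A_{2n-1}$).
   Context: Base-level notation with respect to $2n$: $a=r^{\ell}$ means $a=r+2n\ell$ with $r\in\{1,\ldots,2n\}$, $\ell\in\mathbb{Z}$. Let $\widetilde A_{2n-1}$ be the group of bijections $w:\mathbb{Z}\to\mathbb{Z}$ with $w(x+2n)=w(x)+2n$ and $\sum_{i=1}^{2n}w(i)=\binom{2n+1}{2}$; $\mathcal{M}(A_{2n-1})$ denotes those $w$ with $w(1)<\cdots<w(2n)$ (these are the minimal length coset representatives of $\widetilde A_{2n-1}/A_{2n-1}$ and correspond bijectively to dominant alcoves $w\mathcal{A}_0$ of the affine Shi arrangement of type $A_{2n-1}$). The abacus of $w$ is $[r_1^{\ell_1},\ldots,r_{2n}^{\ell_{2n}}]$, the base window $[w(1),\ldots,w(2n)]$ in base-level notation; the level vector $(\beta_1,\ldots,\beta_{2n})$ has $\beta_i$ equal to the level of the entry with base $i$. For $w\in\mathcal{M}(A_{2n-1})$, $\mathsf{T}(w)$ is the staircase array $(k_{ij})_{1\le i\le j\le 2n-1}$ (with $k_{ij}$ in row $i$, column $2n-j$) given by $k_{ij}=\ell_{j+1}-\ell_i$ if $r_i<r_{j+1}$ and $k_{ij}=\ell_{j+1}-\ell_i-1$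 if $r_i>r_{j+1}$; it is known that $\mathsf{T}$ is a bijection from $\mathcal{M}(A_{2n-1})$ onto the set of Shi tableaux of type $A_{2n-1}$ (the arrays recording, for each positive root $\alpha_{ij}=\varepsilon_i-\varepsilon_{j+1}$, the number $k_{ij}$ of hyperplanes $\{x:\langle x,\alpha_{ij}\rangle=k\}$, $k\ge1$, separating the alcove from the origin). A tableau is self-conjugate if $k_{ij}=k_{2n-j,\,2n-i}$ for all $1\le i\le j\le 2n-1$. -}

module Defs where

open import Data.Nat as ℕ using (ℕ; zero; suc)
open import Data.Nat.Combinatorics using (_C_)
open import Data.Integer as ℤ using (ℤ; +_; _/ℕ_; _%ℕ_)
open import Data.Product using (Σ; ∃; _×_)
open import Data.Bool using (if_then_else_)
open import Relation.Nullary.Decidable using (⌊_⌋)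
open import Relation.Binary.PropositionalEquality using (_≡_)
open import Function.Definitions using (Bijective)

-- Throughout, n is the parameter of type A_{2n-1}; the period is N = 2n.

sumFrom1 : ℕ → (ℕ → ℤ) → ℤ
sumFrom1 zero    f = + 0
sumFrom1 (suc m) f = sumFrom1 m f ℤ.+ f (suc m)

IsAffinePerm : ℕ → (ℤ → ℤ) → Set
IsAffinePerm n w =
  Bijective _≡_ _≡_ w
  × (∀ x → w (x ℤ.+ + (2 ℕ.* n)) ≡ w x ℤ.+ + (2 ℕ.* n))
  × (sumFrom1 (2 ℕ.* n) (λ i → w (+ i)) ≡ + ((2 ℕ.* n ℕ.+ 1) C 2))

InM : ℕ → (ℤ → ℤ) → Set
InM n w = IsAffinePerm n w
  × (∀ (i : ℕ) → 1 ℕ.≤ i → i ℕ.< 2 ℕ.* n → w (+ i) ℤ.< w (+ (suc i)))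

-- Base-level notation w.r.t. 2n: a = r + 2n·ℓ with r ∈ {1,…,2n}.
-- (For n = 0 junk values are used; the theorem assumes n ≥ 1.)
level : ℕ → ℤ → ℤ
level zero    a = + 0
level (suc k) a = (a ℤ.- + 1) /ℕ (2 ℕ.* suc k)

base : ℕ → ℤ → ℕ
base zero    a = 0
base (suc k) a = suc ((a ℤ.- + 1) %ℕ (2 ℕ.* suc k))

r : ℕ → (ℤ → ℤ) → ℕ → ℕ
r n w i = base n (w (+ i))

ℓ : ℕ → (ℤ → ℤ) → ℕ → ℤ
ℓ n w i = level n (w (+ i))

-- Level vector antisymmetric: β_b = - β_{2n+1-b} for all bases b, where
-- β_b is the level of the window entry with base b.
AntisymLevels : ℕ → (ℤ → ℤ) → Set
AntisymLevels n w =
  ∀ (i j : ℕ) → 1 ℕ.≤ i → i ℕ.≤ 2 ℕ.* n → 1 ℕ.≤ j → j ℕ.≤ 2 ℕ.* n →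
  r n w i ℕ.+ r n w j ≡ 2 ℕ.* n ℕ.+ 1 → ℓ n w i ≡ ℤ.- ℓ n w j

-- A staircase array (k_ij)_{1 ≤ i ≤ j ≤ 2n-1}, represented as a function on
-- ℕ × ℕ of which only the entries with 1 ≤ i ≤ j ≤ 2n-1 are meaningful.
Tableau : Set
Tableau = ℕ → ℕ → ℤ

InRange : ℕ → ℕ → ℕ → Set
InRange n i j = 1 ℕ.≤ i × i ℕ.≤ j × j ℕ.≤ 2 ℕ.* n ℕ.∸ 1

TabEq : ℕ → Tableau → Tableau → Set
TabEq n s t = ∀ i j → InRange n i j → s i j ≡ t i j

T : ℕ → (ℤ → ℤ) → Tableau
T n w i j =
  if ⌊ r n w (suc j) ℕ.<? r n w i ⌋
  then ℓ n w (suc j) ℤ.- ℓ n w i ℤ.- + 1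
  else ℓ n w (suc j) ℤ.- ℓ n w i

-- Shi tableaux of type A_{2n-1}: the Shi tableaux of dominant alcoves w𝒜₀,
-- i.e. (by the known bijection 𝖳 : M(A_{2n-1}) → Shi tableaux) the arrays 𝖳(w), w ∈ M.
IsShiTableau : ℕ → Tableau → Set
IsShiTableau n t = ∃ λ w → InM n w × TabEq n (T n w) t

SelfConjugate : ℕ → Tableau → Set
SelfConjugate n t =
  ∀ i j → InRange n i j → t i j ≡ t (2 ℕ.* n ℕ.∸ j) (2 ℕ.* n ℕ.∸ i)

{-# OPTIONS --safe #-}
-- An entry k_ij of 𝖳(w) is ⌊(w(j+1) − w(i)) / 2n⌋, and for injective 2n-periodic w and
-- i ≤ j this difference is never a multiple of 2n.  So if 𝖳(w) = 𝖳(w′), then w(y) = w(x) + 1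
-- forces w′(x) < w′(y): w′ − w is monotone along the values of w, is 2n-periodic, hence
-- constant, and equal window sums make it 0.
--
-- The involution reflect w x = 2n+1 − w(2n+1−x) has the differences of w read backwards, so
-- 𝖳(reflect w) is the conjugate of 𝖳(w); as it also preserves the window sum, 𝖳(w) is
-- self-conjugate exactly when reflect w = w.  On the window this is w(2n+1−i) = 2n+1 − w(i),
-- which in base-level notation reads β_b = −β_{2n+1−b}.  Conversely, antisymmetric levels make
-- the window values closed under v ↦ 2n+1−v, and w, reflect w are increasing enumerations of
-- that one set, so they agree.
module Submission where

open import Defs
open import Data.Nat using (ℕ; _≤_)
open import Data.Integer using (ℤ)
open import Data.Product using (∃; _×_)
open import Relation.Binary.PropositionalEquality using (_≡_)

import Data.Nat as ℕ
open import Data.Nat using (zero; suc; z≤n; s≤s; _<_; _∸_)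
import Data.Nat.Properties as ℕP
import Data.Nat.Tactic.RingSolver as ℕSolver
open import Data.Nat.Combinatorics using (_C_; nC1≡n; nCk+nC[k+1]≡[n+1]C[k+1])
open import Data.Integer using (+_; -[1+_]; _+_; _-_; _*_; -_; ∣_∣)
  renaming (_≤_ to _≤ℤ_; _<_ to _<ℤ_)
import Data.Integer as ℤ
import Data.Integer.Properties as ℤP
import Data.Integer.DivMod as ℤDivMod
open import Data.Integer.Tactic.RingSolver using (solve-∀)
open import Data.Product using (_,_; proj₁; proj₂)
open import Relation.Binary.PropositionalEquality
  using (_≢_; refl; sym; trans; cong; cong₂; subst; subst₂; module ≡-Reasoning)
open import Data.Sum using (inj₁; inj₂)
open import Relation.Nullary using (Dec; yes; no; contradiction)
open import Relation.Binary.Definitions using (tri<; tri≈; tri>)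
open import Relation.Nullary.Decidable using (⌊_⌋)
open import Data.Bool using (if_then_else_)
open import Function.Definitions using (Injective; Surjective)

pos-∸ : ∀ {m k} → k ≤ m → + (m ∸ k) ≡ + m - + k
pos-∸ {m} {k} k≤m = sym (trans (ℤP.[+m]-[+n]≡m⊖n m k) (ℤP.⊖-≥ k≤m))

i≤+∣i∣ : ∀ i → i ≤ℤ + ∣ i ∣
i≤+∣i∣ (+ _) = ℤP.≤-refl
i≤+∣i∣ -[1+ _ ] = ℤ.-≤+

i≤j⇒j≡i+∣j-i∣ : ∀ {i j} → i ≤ℤ j → j ≡ i + + ∣ j - i ∣
i≤j⇒j≡i+∣j-i∣ {i} {j} i≤j =
  trans (cancel i j) (cong (λ u → i + u) (sym (ℤP.0≤i⇒+∣i∣≡i (ℤP.i≤j⇒0≤j-i i≤j))))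
  where
  cancel : ∀ i j → j ≡ i + (j - i)
  cancel = solve-∀

k<j-i⇒i+k<j : ∀ {i j k} → k <ℤ j - i → i + k <ℤ j
k<j-i⇒i+k<j {i} {j} k<j-i = subst (i + _ <ℤ_) (cancel i j) (ℤP.+-monoʳ-< i k<j-i)
  where
  cancel : ∀ i j → i + (j - i) ≡ j
  cancel = solve-∀

IsFloorDiv : ℕ → ℤ → ℤ → Set
IsFloorDiv N D q = q * + N ≤ℤ D × D <ℤ q * + N + + N

isFloorDiv : ∀ {N D q e} → D ≡ q * + N + + e → e < N → IsFloorDiv N D q
isFloorDiv {N} {q = q} {e} refl e<N =
  ℤP.i≤i+j (q * + N) (+ e) , ℤP.+-monoʳ-< (q * + N) (ℤ.+<+ e<N)

isFloorDiv-strict : ∀ {N D q e} → D ≡ q * + N + + e → 0 < e → q * + N <ℤ D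
isFloorDiv-strict {N} {q = q} {e} refl 0<e =
  subst (_<ℤ q * + N + + e) (ℤP.+-identityʳ (q * + N)) (ℤP.+-monoʳ-< (q * + N) (ℤ.+<+ 0<e))

isFloorDiv-≤ : ∀ {N D q q′} → IsFloorDiv N D q → IsFloorDiv N D q′ → q ≤ℤ q′
isFloorDiv-≤ {N} {D} {q} {q′} (qN≤D , _) (_ , D<q′N+N) =
  subst (q ≤ℤ_) (ℤP.pred-suc q′) (ℤP.i<j⇒i≤pred[j] (ℤP.*-cancelʳ-<-nonNeg {q} {ℤ.suc q′} (+ N) qN<[1+q′]N))
  where
  distrib : ∀ x c → x * c + c ≡ (+ 1 + x) * c
  distrib = solve-∀
  qN<[1+q′]N : q * + N <ℤ ℤ.suc q′ * + N
  qN<[1+q′]N = ℤP.≤-<-trans qN≤D (subst (D <ℤ_) (distrib q′ (+ N)) D<q′N+N)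

isFloorDiv-unique : ∀ {N D q q′} → IsFloorDiv N D q → IsFloorDiv N D q′ → q ≡ q′
isFloorDiv-unique f f′ = ℤP.≤-antisym (isFloorDiv-≤ f f′) (isFloorDiv-≤ f′ f)

Periodic : ℕ → (ℤ → ℤ) → Set
Periodic N w = ∀ x → w (x + + N) ≡ w x + + N

module _ {N : ℕ} (w : ℤ → ℤ) (periodic : Periodic N w) where
  open ≡-Reasoning

  periodic-ℕ* : ∀ x m → w (x + + m * + N) ≡ w x + + m * + N
  periodic-ℕ* x zero = trans (cong w (ℤP.+-identityʳ x)) (sym (ℤP.+-identityʳ (w x)))
  periodic-ℕ* x (suc m) = begin
    w (x + + suc m * + N)     ≡⟨ cong w (split x (+ m) (+ N)) ⟩
    w (x + + m * + N + + N)   ≡⟨ periodic _ ⟩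
    w (x + + m * + N) + + N   ≡⟨ cong (_+ + N) (periodic-ℕ* x m) ⟩
    w x + + m * + N + + N     ≡⟨ split (w x) (+ m) (+ N) ⟨
    w x + + suc m * + N       ∎
    where
    split : ∀ x m c → x + (+ 1 + m) * c ≡ x + m * c + c
    split = solve-∀

  periodic-* : ∀ x p → w (x + p * + N) ≡ w x + p * + N
  periodic-* x (+ m) = periodic-ℕ* x m
  periodic-* x -[1+ m ] = begin
    w y                                       ≡⟨ cancel (w y) (+ suc m) (+ N) ⟩
    w y + + suc m * + N + - + suc m * + N     ≡⟨ cong (_+ - + suc m * + N) (periodic-ℕ* y (suc m)) ⟨
    w (y + + suc m * + N) + - + suc m * + N   ≡⟨ cong (λ z → w z + - + suc m * + N) (cancel x (- + suc m) (+ N)) ⟨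
    w x + -[1+ m ] * + N                      ∎
    where
    y : ℤ
    y = x + -[1+ m ] * + N
    cancel : ∀ x p c → x ≡ x + p * c + - p * c
    cancel = solve-∀

sumFrom1-cong : ∀ m {f g : ℕ → ℤ} → (∀ i → 1 ≤ i → i ≤ m → f i ≡ g i) → sumFrom1 m f ≡ sumFrom1 m g
sumFrom1-cong zero    f≡g = refl
sumFrom1-cong (suc m) f≡g = cong₂ _+_ (sumFrom1-cong m (λ i 1≤i i≤m → f≡g i 1≤i (ℕP.m≤n⇒m≤1+n i≤m)))
                                      (f≡g (suc m) (s≤s z≤n) ℕP.≤-refl)

sumFrom1-shift : ∀ m (f : ℕ → ℤ) c → sumFrom1 m (λ i → f i + c) ≡ sumFrom1 m f + + m * c
sumFrom1-shift zero    f c = zero-sum c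
  where
  zero-sum : ∀ c → + 0 ≡ + 0 + + 0 * c
  zero-sum = solve-∀
sumFrom1-shift (suc m) f c = trans (cong (_+ (f (suc m) + c)) (sumFrom1-shift m f c))
                               (regroup (sumFrom1 m f) (f (suc m)) (+ m) c)
  where
  regroup : ∀ S x m c → (S + m * c) + (x + c) ≡ (S + x) + (+ 1 + m) * c
  regroup = solve-∀

sumFrom1-complement : ∀ m c (f : ℕ → ℤ) → sumFrom1 m (λ i → c - f i) ≡ + m * c - sumFrom1 m f
sumFrom1-complement zero    c f = zero-sum c
  where
  zero-sum : ∀ c → + 0 ≡ + 0 * c - + 0
  zero-sum = solve-∀
sumFrom1-complement (suc m) c f = trans (cong (_+ (c - f (suc m))) (sumFrom1-complement m c f))
                                    (regroup (+ m) c (sumFrom1 m f) (f (suc m)))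
  where
  regroup : ∀ m c S x → (m * c - S) + (c - x) ≡ (+ 1 + m) * c - (S + x)
  regroup = solve-∀

sumFrom1-unroll : ∀ m (f : ℕ → ℤ) → sumFrom1 m (λ i → f (suc i)) + f 1 ≡ sumFrom1 (suc m) f
sumFrom1-unroll zero    f = refl
sumFrom1-unroll (suc m) f = trans (swap (sumFrom1 m (λ i → f (suc i))) (f (suc (suc m))) (f 1))
                                  (cong (_+ f (suc (suc m))) (sumFrom1-unroll m f))
  where
  swap : ∀ a b c → (a + b) + c ≡ (a + c) + b
  swap = solve-∀

sumFrom1-reverse : ∀ m (f : ℕ → ℤ) → sumFrom1 m (λ i → f (suc m ∸ i)) ≡ sumFrom1 m f
sumFrom1-reverse zero    f = refl
sumFrom1-reverse (suc m) f = begin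
  sumFrom1 m (λ i → f (suc (suc m) ∸ i)) + f (suc m ∸ m)
    ≡⟨ cong₂ _+_ (sumFrom1-cong m shift) (cong f (ℕP.m+n∸n≡m 1 m)) ⟩
  sumFrom1 m (λ i → f (suc (suc m ∸ i))) + f 1
    ≡⟨ cong (_+ f 1) (sumFrom1-reverse m (λ i → f (suc i))) ⟩
  sumFrom1 m (λ i → f (suc i)) + f 1
    ≡⟨ sumFrom1-unroll m f ⟩
  sumFrom1 (suc m) f
    ∎
  where
  open ≡-Reasoning
  shift : ∀ i → 1 ≤ i → i ≤ m → f (suc (suc m) ∸ i) ≡ f (suc (suc m ∸ i))
  shift i _ i≤m = cong f (ℕP.+-∸-assoc 1 (ℕP.m≤n⇒m≤1+n i≤m))

[m+1]C2+[m+1]C2≡m*[1+m] : ∀ m → (m ℕ.+ 1) C 2 ℕ.+ (m ℕ.+ 1) C 2 ≡ m ℕ.* suc m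
[m+1]C2+[m+1]C2≡m*[1+m] zero    = refl
[m+1]C2+[m+1]C2≡m*[1+m] (suc m) = begin
  X′ ℕ.+ X′                                  ≡⟨ cong (λ x → x ℕ.+ x) pascal ⟨
  (m ℕ.+ 1 ℕ.+ X) ℕ.+ (m ℕ.+ 1 ℕ.+ X)       ≡⟨ regroup m X ⟩
  2 ℕ.* (m ℕ.+ 1) ℕ.+ (X ℕ.+ X)             ≡⟨ cong (2 ℕ.* (m ℕ.+ 1) ℕ.+_) ([m+1]C2+[m+1]C2≡m*[1+m] m) ⟩
  2 ℕ.* (m ℕ.+ 1) ℕ.+ m ℕ.* suc m           ≡⟨ expand m ⟩
  suc m ℕ.* suc (suc m)                      ∎
  where
  open ≡-Reasoning
  X X′ : ℕ
  X = (m ℕ.+ 1) C 2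
  X′ = (suc m ℕ.+ 1) C 2
  pascal : m ℕ.+ 1 ℕ.+ X ≡ X′
  pascal = trans (cong (ℕ._+ X) (sym (nC1≡n (m ℕ.+ 1)))) (nCk+nC[k+1]≡[n+1]C[k+1] (m ℕ.+ 1) 1)
  regroup : ∀ m X → (m ℕ.+ 1 ℕ.+ X) ℕ.+ (m ℕ.+ 1 ℕ.+ X) ≡ 2 ℕ.* (m ℕ.+ 1) ℕ.+ (X ℕ.+ X)
  regroup = ℕSolver.solve-∀
  expand : ∀ m → 2 ℕ.* (m ℕ.+ 1) ℕ.+ m ℕ.* suc m ≡ suc m ℕ.* suc (suc m)
  expand = ℕSolver.solve-∀

StrictlyIncreasing : ℕ → (ℕ → ℤ) → Set
StrictlyIncreasing N f = ∀ i → 1 ≤ i → i < N → f i <ℤ f (suc i)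

module _ {N : ℕ} {f : ℕ → ℤ} (increasing : StrictlyIncreasing N f) where

  increasing-mono : ∀ {i j} → 1 ≤ i → i ≤ j → j ≤ N → f i ≤ℤ f j
  increasing-mono {i} {zero}  1≤i i≤0 _ = contradiction (ℕP.≤-trans 1≤i i≤0) λ ()
  increasing-mono {i} {suc j} 1≤i i≤j+1 j<N with ℕP.m≤n⇒m<n∨m≡n i≤j+1
  ... | inj₂ refl      = ℤP.≤-refl
  ... | inj₁ (s≤s i≤j) = ℤP.≤-trans (increasing-mono 1≤i i≤j (ℕP.<⇒≤ j<N))
                                    (ℤP.<⇒≤ (increasing j (ℕP.≤-trans 1≤i i≤j) j<N))


module _ {N : ℕ} {f g : ℕ → ℤ} (f-increasing : StrictlyIncreasing N f) (g-increasing : StrictlyIncreasing N g)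
         (f⊆g : ∀ i → 1 ≤ i → i ≤ N → ∃ λ j → 1 ≤ j × j ≤ N × g j ≡ f i) where

  -- If f i = g jᵢ, then i < i′ forces jᵢ < jᵢ′, so jᵢ ≥ i.
  position-≥ : ∀ i → 1 ≤ i → i ≤ N → ∃ λ j → i ≤ j × j ≤ N × g j ≡ f i
  position-≥ (suc zero) 1≤i i≤N = f⊆g 1 1≤i i≤N
  position-≥ (suc (suc i)) _ i<N
    with position-≥ (suc i) (s≤s z≤n) (ℕP.<⇒≤ i<N) | f⊆g (suc (suc i)) (s≤s z≤n) i<N
  ... | j , i<j , j≤N , gj≡ | j′ , 1≤j′ , j′≤N , gj′≡ with j′ ℕ.≤? j
  ...   | yes j′≤j = contradiction (ℤP.<-≤-trans (f-increasing (suc i) (s≤s z≤n) i<N)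
                       (subst₂ _≤ℤ_ gj′≡ gj≡ (increasing-mono {f = g} g-increasing 1≤j′ j′≤j j≤N)))
                       (ℤP.<-irrefl refl)
  ...   | no j′≰j  = j′ , ℕP.<-≤-trans (s≤s i<j) (ℕP.≰⇒> j′≰j) , j′≤N , gj′≡

  increasing-⊆⇒≤ : ∀ i → 1 ≤ i → i ≤ N → g i ≤ℤ f i
  increasing-⊆⇒≤ i 1≤i i≤N with position-≥ i 1≤i i≤N
  ... | j , i≤j , j≤N , gj≡ = subst (g i ≤ℤ_) gj≡ (increasing-mono {f = g} g-increasing 1≤i i≤j j≤N)

i-j≡i-k⇒j≡k : ∀ i {j k} → i - j ≡ i - k → j ≡ k
i-j≡i-k⇒j≡k i {j} {k} eq = trans (twice i j) (trans (cong (λ u → i - u) eq) (sym (twice i k)))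
  where
  twice : ∀ i j → j ≡ i - (i - j)
  twice = solve-∀

reflect : ℕ → (ℤ → ℤ) → ℤ → ℤ
reflect N w x = + suc N - w (+ suc N - x)

module _ {N : ℕ} (w : ℤ → ℤ) where
  open ≡-Reasoning

  reflect-injective : Injective _≡_ _≡_ w → Injective _≡_ _≡_ (reflect N w)
  reflect-injective injective eq = i-j≡i-k⇒j≡k (+ suc N) (injective (i-j≡i-k⇒j≡k (+ suc N) eq))

  reflect-periodic : Periodic N w → Periodic N (reflect N w)
  reflect-periodic periodic x = begin
    S - w (S - (x + + N))              ≡⟨ cong (λ y → S - w y) (regroup S x (+ N)) ⟩
    S - w (S - x + - + 1 * + N)        ≡⟨ cong (λ y → S - y) (periodic-* w periodic (S - x) (- + 1)) ⟩
    S - (w (S - x) + - + 1 * + N)      ≡⟨ regroup′ S (w (S - x)) (+ N) ⟩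
    S - w (S - x) + + N                ∎
    where
    S : ℤ
    S = + suc N
    regroup : ∀ S x c → S - (x + c) ≡ S - x + - + 1 * c
    regroup = solve-∀
    regroup′ : ∀ S y c → S - (y + - + 1 * c) ≡ S - y + c
    regroup′ = solve-∀

  reflect-window : ∀ {i} → i ≤ suc N → reflect N w (+ i) ≡ + suc N - w (+ (suc N ∸ i))
  reflect-window i≤N+1 = cong (λ y → + suc N - w y) (sym (pos-∸ i≤N+1))

  reflect-sum : sumFrom1 N (λ i → reflect N w (+ i)) ≡ + N * + suc N - sumFrom1 N (λ i → w (+ i))
  reflect-sum = begin
    sumFrom1 N (λ i → reflect N w (+ i))
      ≡⟨ sumFrom1-cong N (λ i _ i≤N → reflect-window (ℕP.m≤n⇒m≤1+n i≤N)) ⟩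
    sumFrom1 N (λ i → + suc N - w (+ (suc N ∸ i)))
      ≡⟨ sumFrom1-complement N (+ suc N) (λ i → w (+ (suc N ∸ i))) ⟩
    + N * + suc N - sumFrom1 N (λ i → w (+ (suc N ∸ i)))
      ≡⟨ cong (λ y → + N * + suc N - y) (sumFrom1-reverse N (λ i → w (+ i))) ⟩
    + N * + suc N - sumFrom1 N (λ i → w (+ i))
      ∎

module Abacus (k : ℕ) where

  n N : ℕ
  n = suc k
  N = 2 ℕ.* n

  level-isFloorDiv : ∀ a → IsFloorDiv N (a - + 1) (level n a)
  level-isFloorDiv a = isFloorDiv {q = level n a} {e = base n a ∸ 1}
    (trans (ℤDivMod.a≡a%ℕn+[a/ℕn]*n (a - + 1) N) (ℤP.+-comm (+ (base n a ∸ 1)) (level n a * + N)))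
    (ℤDivMod.n%ℕd<d (a - + 1) N)

  base-level : ∀ a → a ≡ + base n a + level n a * + N
  base-level a = begin
    a
      ≡⟨ shift a ⟩
    (a - + 1) + + 1
      ≡⟨ cong (_+ + 1) (ℤDivMod.a≡a%ℕn+[a/ℕn]*n (a - + 1) N) ⟩
    + ((a - + 1) ℤ.%ℕ N) + (a - + 1) ℤ./ℕ N * + N + + 1
      ≡⟨ reorder (+ ((a - + 1) ℤ.%ℕ N)) ((a - + 1) ℤ./ℕ N * + N) ⟩
    + base n a + level n a * + N
      ∎
    where
    open ≡-Reasoning
    shift : ∀ a → a ≡ (a - + 1) + + 1
    shift = solve-∀
    reorder : ∀ x y → x + y + + 1 ≡ + 1 + x + y
    reorder = solve-∀

  base≤N : ∀ a → base n a ≤ N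
  base≤N a = ℤDivMod.n%ℕd<d (a - + 1) N

  base-level-unique : ∀ {a c p} → a ≡ + c + p * + N → 1 ≤ c → c ≤ N →
                      base n a ≡ c × level n a ≡ p
  base-level-unique {a} {suc c} {p} a≡ _ c<N = ℤP.+-injective base≡ , level≡
    where
    open ≡-Reasoning
    drop-one : ∀ c x → (+ 1 + c + x) - + 1 ≡ x + c
    drop-one = solve-∀
    move : ∀ a b x → a ≡ b + x → b ≡ a - x
    move a b x refl = cancel b x
      where
      cancel : ∀ b x → b ≡ b + x - x
      cancel = solve-∀
    level≡ : level n a ≡ p
    level≡ = isFloorDiv-unique (level-isFloorDiv a)
               (isFloorDiv {q = p} {e = c} (trans (cong (_- + 1) a≡) (drop-one (+ c) (p * + N))) c<N)
    base≡ : + base n a ≡ + suc c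
    base≡ = begin
      + base n a             ≡⟨ move a _ _ (base-level a) ⟩
      a - level n a * + N    ≡⟨ cong (λ q → a - q * + N) level≡ ⟩
      a - p * + N            ≡⟨ move a _ _ a≡ ⟨
      + suc c                ∎

  window-mod-unique : ∀ {a b p} → 1 ≤ a → a ≤ N → 1 ≤ b → b ≤ N → + a ≡ + b + p * + N → a ≡ b
  window-mod-unique {a} {b} {p} 1≤a a≤N 1≤b b≤N a≡ =
    trans (sym (proj₁ (base-level-unique {p = + 0} (sym (ℤP.+-identityʳ (+ a))) 1≤a a≤N)))
          (proj₁ (base-level-unique {p = p} a≡ 1≤b b≤N))

  periodic-base-level : ∀ v → Periodic N v → ∀ x → v x ≡ v (+ base n x) + level n x * + N
  periodic-base-level v periodic x =
    trans (cong v (base-level x)) (periodic-* v periodic (+ base n x) (level n x))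

  T-decomposition : ∀ w i j → ∃ λ e → e < N × (r n w i ≢ r n w (suc j) → 0 < e) ×
                    w (+ suc j) - w (+ i) ≡ T n w i j * + N + + e
  T-decomposition w i j = decompose (rⱼ₊₁ ℕ.<? rᵢ)
    where
    open ≡-Reasoning
    rᵢ rⱼ₊₁ : ℕ
    rᵢ = r n w i
    rⱼ₊₁ = r n w (suc j)
    ℓᵢ ℓⱼ₊₁ : ℤ
    ℓᵢ = ℓ n w i
    ℓⱼ₊₁ = ℓ n w (suc j)
    D≡ : w (+ suc j) - w (+ i) ≡ (+ rⱼ₊₁ + ℓⱼ₊₁ * + N) - (+ rᵢ + ℓᵢ * + N)
    D≡ = cong₂ _-_ (base-level (w (+ suc j))) (base-level (w (+ i)))
    borrow : ∀ r′ ℓ′ r ℓ c → (r′ + ℓ′ * c) - (r + ℓ * c) ≡ (ℓ′ - ℓ - + 1) * c + (r′ + (c - r))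
    borrow = solve-∀
    regroup : ∀ r′ ℓ′ r ℓ c → (r′ + ℓ′ * c) - (r + ℓ * c) ≡ (ℓ′ - ℓ) * c + (r′ - r)
    regroup = solve-∀
    decompose : (d : Dec (rⱼ₊₁ < rᵢ)) → ∃ λ e → e < N × (rᵢ ≢ rⱼ₊₁ → 0 < e) ×
                w (+ suc j) - w (+ i) ≡ (if ⌊ d ⌋ then ℓⱼ₊₁ - ℓᵢ - + 1 else ℓⱼ₊₁ - ℓᵢ) * + N + + e
    decompose (yes rⱼ₊₁<rᵢ) =
      rⱼ₊₁ ℕ.+ (N ∸ rᵢ) , e<N , (λ _ → ℕP.<-≤-trans (s≤s z≤n) (ℕP.m≤m+n rⱼ₊₁ _)) , (begin
        w (+ suc j) - w (+ i)
          ≡⟨ D≡ ⟩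
        (+ rⱼ₊₁ + ℓⱼ₊₁ * + N) - (+ rᵢ + ℓᵢ * + N)
          ≡⟨ borrow (+ rⱼ₊₁) ℓⱼ₊₁ (+ rᵢ) ℓᵢ (+ N) ⟩
        (ℓⱼ₊₁ - ℓᵢ - + 1) * + N + (+ rⱼ₊₁ + (+ N - + rᵢ))
          ≡⟨ cong (λ x → (ℓⱼ₊₁ - ℓᵢ - + 1) * + N + (+ rⱼ₊₁ + x)) (pos-∸ (base≤N (w (+ i)))) ⟨
        (ℓⱼ₊₁ - ℓᵢ - + 1) * + N + + (rⱼ₊₁ ℕ.+ (N ∸ rᵢ))
          ∎)
      where
      e<N : rⱼ₊₁ ℕ.+ (N ∸ rᵢ) < N
      e<N = subst (rⱼ₊₁ ℕ.+ (N ∸ rᵢ) <_) (ℕP.m+[n∸m]≡n (base≤N (w (+ i))))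
                  (ℕP.+-monoˡ-< (N ∸ rᵢ) rⱼ₊₁<rᵢ)
    decompose (no rⱼ₊₁≮rᵢ) =
      rⱼ₊₁ ∸ rᵢ , e<N , (λ rᵢ≢rⱼ₊₁ → ℕP.m<n⇒0<n∸m (ℕP.≤∧≢⇒< rᵢ≤rⱼ₊₁ rᵢ≢rⱼ₊₁)) ,
      (begin
        w (+ suc j) - w (+ i)
          ≡⟨ D≡ ⟩
        (+ rⱼ₊₁ + ℓⱼ₊₁ * + N) - (+ rᵢ + ℓᵢ * + N)
          ≡⟨ regroup (+ rⱼ₊₁) ℓⱼ₊₁ (+ rᵢ) ℓᵢ (+ N) ⟩
        (ℓⱼ₊₁ - ℓᵢ) * + N + (+ rⱼ₊₁ - + rᵢ)
          ≡⟨ cong (λ x → (ℓⱼ₊₁ - ℓᵢ) * + N + x) (pos-∸ rᵢ≤rⱼ₊₁) ⟨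
        (ℓⱼ₊₁ - ℓᵢ) * + N + + (rⱼ₊₁ ∸ rᵢ)
          ∎)
      where
      rᵢ≤rⱼ₊₁ : rᵢ ≤ rⱼ₊₁
      rᵢ≤rⱼ₊₁ = ℕP.≮⇒≥ rⱼ₊₁≮rᵢ
      e<N : rⱼ₊₁ ∸ rᵢ < N
      e<N = ℕP.<-≤-trans (ℕP.∸-monoʳ-< {o = 0} (s≤s z≤n) rᵢ≤rⱼ₊₁) (base≤N (w (+ suc j)))

  T-isFloorDiv : ∀ w i j → IsFloorDiv N (w (+ suc j) - w (+ i)) (T n w i j)
  T-isFloorDiv w i j with T-decomposition w i j
  ... | e , e<N , _ , D≡ = isFloorDiv {q = T n w i j} D≡ e<N

  T-determined-by-difference : ∀ v i j w i′ j′ → v (+ suc j) - v (+ i) ≡ w (+ suc j′) - w (+ i′) →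
                               T n v i j ≡ T n w i′ j′
  T-determined-by-difference v i j w i′ j′ D≡ =
    isFloorDiv-unique (T-isFloorDiv v i j)
                      (subst (λ D → IsFloorDiv N D (T n w i′ j′)) (sym D≡) (T-isFloorDiv w i′ j′))

  module _ {w : ℤ → ℤ} (injective : Injective _≡_ _≡_ w) (periodic : Periodic N w) where

    window-bases-distinct : ∀ {a b} → 1 ≤ a → a ≤ N → 1 ≤ b → b ≤ N → r n w a ≡ r n w b → a ≡ b
    window-bases-distinct {a} {b} 1≤a a≤N 1≤b b≤N rₐ≡r_b =
      sym (window-mod-unique {p = ℓ n w b - ℓ n w a} 1≤b b≤N 1≤a a≤N (injective (begin
        w (+ b)                                         ≡⟨ base-level (w (+ b)) ⟩
        + r n w b + ℓ n w b * + N                       ≡⟨ cong (λ c → + c + ℓ n w b * + N) rₐ≡r_b ⟨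
        + r n w a + ℓ n w b * + N                       ≡⟨ rebase (+ r n w a) (ℓ n w b) (ℓ n w a) (+ N) ⟩
        (+ r n w a + ℓ n w a * + N) + (ℓ n w b - ℓ n w a) * + N
                                                        ≡⟨ cong (_+ (ℓ n w b - ℓ n w a) * + N) (base-level (w (+ a))) ⟨
        w (+ a) + (ℓ n w b - ℓ n w a) * + N             ≡⟨ periodic-* w periodic (+ a) (ℓ n w b - ℓ n w a) ⟨
        w (+ a + (ℓ n w b - ℓ n w a) * + N)             ∎)))
      where
      open ≡-Reasoning
      rebase : ∀ x p q c → x + p * c ≡ (x + q * c) + (p - q) * c
      rebase = solve-∀

    T-strict : ∀ {i j} → 1 ≤ i → i ≤ j → suc j ≤ N → T n w i j * + N <ℤ w (+ suc j) - w (+ i)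
    T-strict {i} {j} 1≤i i≤j j<N with T-decomposition w i j
    ... | e , _ , distinct⇒0<e , D≡ = isFloorDiv-strict {q = T n w i j} D≡ (distinct⇒0<e bases-distinct)
      where
      bases-distinct : r n w i ≢ r n w (suc j)
      bases-distinct rᵢ≡rⱼ₊₁ = ℕP.<-irrefl
        (window-bases-distinct 1≤i (ℕP.≤-trans (ℕP.m≤n⇒m≤1+n i≤j) j<N) (s≤s z≤n) j<N rᵢ≡rⱼ₊₁) (s≤s i≤j)

  1<N : 1 < N
  1<N = ℕP.*-monoʳ-≤ 2 (s≤s (z≤n {k}))

  module _ {w w′ : ℤ → ℤ} (w-periodic : Periodic N w)
           (w′-injective : Injective _≡_ _≡_ w′) (w′-periodic : Periodic N w′)
           (same-tableau : TabEq n (T n w) (T n w′)) where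

    window-step : ∀ {a b m} → 1 ≤ a → a ≤ N → 1 ≤ b → b ≤ N →
                  w (+ b) - w (+ a) ≡ m * + N + + 1 → m * + N <ℤ w′ (+ b) - w′ (+ a)
    window-step {a} {b} {m} 1≤a a≤N 1≤b b≤N D≡ with ℕP.<-cmp a b
    window-step {a} {suc j} {m} 1≤a a≤N 1≤b b≤N D≡ | tri< (s≤s a≤j) _ _ =
      subst (λ q → q * + N <ℤ w′ (+ suc j) - w′ (+ a)) T′≡m (T-strict w′-injective w′-periodic 1≤a a≤j b≤N)
      where
      T′≡m : T n w′ a j ≡ m
      T′≡m = trans (sym (same-tableau a j (1≤a , a≤j , ℕ.s≤s⁻¹ b≤N)))
                   (isFloorDiv-unique (T-isFloorDiv w a j) (isFloorDiv {q = m} {e = 1} D≡ 1<N))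
    window-step {a} {.a} {m} 1≤a a≤N 1≤b b≤N D≡ | tri≈ _ refl _ =
      contradiction (trans (sym (ℤP.+-inverseʳ (w (+ a)))) (trans D≡ (cong (λ q → q * + N + + 1) m≡0))) λ ()
      where
      m≡0 : m ≡ + 0
      m≡0 = isFloorDiv-unique (isFloorDiv {q = m} {e = 1} D≡ 1<N)
                              (isFloorDiv {q = + 0} {e = 0} (ℤP.+-inverseʳ (w (+ a))) (s≤s z≤n))
    window-step {suc j} {b} {m} 1≤a a≤N 1≤b b≤N D≡ | tri> _ _ (s≤s b≤j) =
      subst₂ _<ℤ_ (sym (negate m (+ N))) (swap (w′ (+ suc j)) (w′ (+ b))) (ℤP.neg-mono-< D′<)
      where
      open ≡-Reasoning
      negate : ∀ m c → m * c ≡ - ((- m - + 1) * c + c)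
      negate = solve-∀
      swap : ∀ x y → - (x - y) ≡ y - x
      swap = solve-∀
      complement : ∀ m c → - (m * c + + 1) ≡ (- m - + 1) * c + (c - + 1)
      complement = solve-∀
      D≡′ : w (+ suc j) - w (+ b) ≡ (- m - + 1) * + N + + (N ∸ 1)
      D≡′ = begin
        w (+ suc j) - w (+ b)               ≡⟨ swap (w (+ b)) (w (+ suc j)) ⟨
        - (w (+ b) - w (+ suc j))           ≡⟨ cong -_ D≡ ⟩
        - (m * + N + + 1)                   ≡⟨ complement m (+ N) ⟩
        (- m - + 1) * + N + (+ N - + 1)     ≡⟨ cong (λ x → (- m - + 1) * + N + x) (pos-∸ (s≤s z≤n)) ⟨
        (- m - + 1) * + N + + (N ∸ 1)       ∎
      T′≡ : T n w′ b j ≡ - m - + 1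
      T′≡ = trans (sym (same-tableau b j (1≤b , b≤j , ℕ.s≤s⁻¹ a≤N)))
                  (isFloorDiv-unique (T-isFloorDiv w b j)
                                     (isFloorDiv {q = - m - + 1} {e = N ∸ 1} D≡′ (ℕP.n<1+n (N ∸ 1))))
      D′< : w′ (+ suc j) - w′ (+ b) <ℤ (- m - + 1) * + N + + N
      D′< = subst (λ q → w′ (+ suc j) - w′ (+ b) <ℤ q * + N + + N) T′≡ (proj₂ (T-isFloorDiv w′ b j))

    step-preserved : ∀ {x y} → w y ≡ w x + + 1 → w′ x <ℤ w′ y
    step-preserved {x} {y} wy≡ = begin-strict
      w′ x
        ≡⟨ periodic-base-level w′ w′-periodic x ⟩
      w′ (+ a) + p * + N
        ≡⟨ regroup (w′ (+ a)) p q (+ N) ⟩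
      (w′ (+ a) + (p - q) * + N) + q * + N
        <⟨ ℤP.+-monoˡ-< (q * + N) (k<j-i⇒i+k<j {w′ (+ a)} {w′ (+ b)}
             (window-step {m = p - q} (s≤s z≤n) (base≤N x) (s≤s z≤n) (base≤N y) D≡)) ⟩
      w′ (+ b) + q * + N
        ≡⟨ periodic-base-level w′ w′-periodic y ⟨
      w′ y
        ∎
      where
      open ℤP.≤-Reasoning
      a b : ℕ
      a = base n x
      b = base n y
      p q : ℤ
      p = level n x
      q = level n y
      regroup : ∀ x p q c → x + p * c ≡ (x + (p - q) * c) + q * c
      regroup = solve-∀
      unshift : ∀ B A p q c → B - A ≡ ((B + q * c) - (A + p * c)) + (p - q) * c
      unshift = solve-∀
      step : ∀ X p q c → (X + + 1) - X + (p - q) * c ≡ (p - q) * c + + 1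
      step = solve-∀
      D≡ : w (+ b) - w (+ a) ≡ (p - q) * + N + + 1
      D≡ = begin-equality
        w (+ b) - w (+ a)                                            ≡⟨ unshift (w (+ b)) (w (+ a)) p q (+ N) ⟩
        (w (+ b) + q * + N) - (w (+ a) + p * + N) + (p - q) * + N    ≡⟨ cong₂ (λ u v → u - v + (p - q) * + N)
                                                                          (periodic-base-level w w-periodic y)
                                                                          (periodic-base-level w w-periodic x) ⟨
        w y - w x + (p - q) * + N                                    ≡⟨ cong (λ u → u - w x + (p - q) * + N) wy≡ ⟩
        (w x + + 1) - w x + (p - q) * + N                            ≡⟨ step (w x) p q (+ N) ⟩
        (p - q) * + N + + 1                                          ∎

    module _ (w-injective : Injective _≡_ _≡_ w) (w-surjective : Surjective _≡_ _≡_ w) where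

      ascent-preserved : ∀ m {x z} → w z ≡ w x + + m → w′ x + + m ≤ℤ w′ z
      ascent-preserved zero {x} {z} wz≡ = ℤP.≤-reflexive (trans (ℤP.+-identityʳ (w′ x))
        (cong w′ (w-injective (trans (sym (ℤP.+-identityʳ (w x))) (sym wz≡)))))
      ascent-preserved (suc m) {x} {z} wz≡ = begin
        w′ x + + suc m        ≡⟨ assoc (w′ x) (+ m) ⟩
        + 1 + (w′ x + + m)    ≤⟨ ℤP.+-monoʳ-≤ (+ 1) (ascent-preserved m wy≡) ⟩
        + 1 + w′ y            ≤⟨ ℤP.i<j⇒suc[i]≤j (step-preserved (trans wz≡ (trans (sym (assoc′ (w x) (+ m)))
                                                                          (cong (_+ + 1) (sym wy≡))))) ⟩
        w′ z                  ∎
        where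
        open ℤP.≤-Reasoning
        assoc : ∀ x m → x + (+ 1 + m) ≡ + 1 + (x + m)
        assoc = solve-∀
        assoc′ : ∀ x m → (x + m) + + 1 ≡ x + (+ 1 + m)
        assoc′ = solve-∀
        y : ℤ
        y = proj₁ (w-surjective (w x + + m))
        wy≡ : w y ≡ w x + + m
        wy≡ = proj₂ (w-surjective (w x + + m)) refl

      shift-monotone : ∀ {x z} → w x ≤ℤ w z → w′ x - w x ≤ℤ w′ z - w z
      shift-monotone {x} {z} wx≤wz = begin
        w′ x - w x                  ≡⟨ cancel (w′ x) (w x) (+ t) ⟩
        (w′ x + + t) - (w x + + t)  ≡⟨ cong (λ u → (w′ x + + t) - u) wz≡ ⟨
        (w′ x + + t) - w z          ≤⟨ ℤP.+-monoˡ-≤ (- w z) (ascent-preserved t wz≡) ⟩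
        w′ z - w z                  ∎
        where
        open ℤP.≤-Reasoning
        t : ℕ
        t = ∣ w z - w x ∣
        wz≡ : w z ≡ w x + + t
        wz≡ = i≤j⇒j≡i+∣j-i∣ wx≤wz
        cancel : ∀ a b t → a - b ≡ (a + t) - (b + t)
        cancel = solve-∀

      shift-constant : ∀ x z → w′ x - w x ≡ w′ z - w z
      shift-constant x z = ℤP.≤-antisym (shift-≤ x z) (shift-≤ z x)
        where
        shift-periodic : ∀ z p → w′ (z + p * + N) - w (z + p * + N) ≡ w′ z - w z
        shift-periodic z p = trans (cong₂ _-_ (periodic-* w′ w′-periodic z p) (periodic-* w w-periodic z p))
                                   (cancel (w′ z) (w z) (p * + N))
          where
          cancel : ∀ a b c → (a + c) - (b + c) ≡ a - b
          cancel = solve-∀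
        shift-≤ : ∀ x z → w′ x - w x ≤ℤ w′ z - w z
        shift-≤ x z = subst (w′ x - w x ≤ℤ_) (shift-periodic z (+ K)) (shift-monotone wx≤wz′)
          where
          open ℤP.≤-Reasoning
          K : ℕ
          K = ∣ w x - w z ∣
          cancel : ∀ a b → a ≡ b + (a - b)
          cancel = solve-∀
          wx≤wz′ : w x ≤ℤ w (z + + K * + N)
          wx≤wz′ = begin
            w x                  ≡⟨ cancel (w x) (w z) ⟩
            w z + (w x - w z)    ≤⟨ ℤP.+-monoʳ-≤ (w z) (i≤+∣i∣ (w x - w z)) ⟩
            w z + + K            ≤⟨ ℤP.+-monoʳ-≤ (w z) (subst (+ K ≤ℤ_) (ℤP.pos-* K N) (ℤ.+≤+ (ℕP.m≤m*n K N))) ⟩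
            w z + + K * + N      ≡⟨ periodic-* w w-periodic z (+ K) ⟨
            w (z + + K * + N)    ∎

      tableau-injective : sumFrom1 N (λ i → w′ (+ i)) ≡ sumFrom1 N (λ i → w (+ i)) → ∀ x → w x ≡ w′ x
      tableau-injective same-sum x = begin
        w x          ≡⟨ ℤP.+-identityʳ (w x) ⟨
        w x + + 0    ≡⟨ cong (λ u → w x + u) c≡0 ⟨
        w x + c      ≡⟨ shifted x ⟨
        w′ x         ∎
        where
        open ≡-Reasoning
        c : ℤ
        c = w′ (+ 0) - w (+ 0)
        split : ∀ a b → a ≡ b + (a - b)
        split = solve-∀
        shifted : ∀ z → w′ z ≡ w z + c
        shifted z = trans (split (w′ z) (w z)) (cong (λ u → w z + u) (shift-constant z (+ 0)))
        S : ℤ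
        S = sumFrom1 N (λ i → w (+ i))
        S+Nc≡S : S + + N * c ≡ S
        S+Nc≡S = begin
          S + + N * c                    ≡⟨ sumFrom1-shift N (λ i → w (+ i)) c ⟨
          sumFrom1 N (λ i → w (+ i) + c) ≡⟨ sumFrom1-cong N (λ i _ _ → shifted (+ i)) ⟨
          sumFrom1 N (λ i → w′ (+ i))    ≡⟨ same-sum ⟩
          S                              ∎
        cancel : ∀ S x → x ≡ S + x - S
        cancel = solve-∀
        c≡0 : c ≡ + 0
        c≡0 = ℤP.*-cancelˡ-≡ (+ N) c (+ 0) (begin
          + N * c            ≡⟨ cancel S (+ N * c) ⟩
          S + + N * c - S    ≡⟨ cong (_- S) S+Nc≡S ⟩
          S - S              ≡⟨ ℤP.+-inverseʳ S ⟩
          + 0                ≡⟨ ℤP.*-zeroʳ (+ N) ⟨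
          + N * + 0          ∎)

  T-reflect : ∀ w {i j} → i ≤ N → j ≤ N → T n (reflect N w) i j ≡ T n w (N ∸ j) (N ∸ i)
  T-reflect w {i} {j} i≤N j≤N = T-determined-by-difference (reflect N w) i j w (N ∸ j) (N ∸ i) (begin
    reflect N w (+ suc j) - reflect N w (+ i)
      ≡⟨ cong₂ _-_ (reflect-window w (s≤s j≤N)) (reflect-window w (ℕP.m≤n⇒m≤1+n i≤N)) ⟩
    (S - w (+ (N ∸ j))) - (S - w (+ (suc N ∸ i)))
      ≡⟨ cancel S (w (+ (N ∸ j))) (w (+ (suc N ∸ i))) ⟩
    w (+ (suc N ∸ i)) - w (+ (N ∸ j))
      ≡⟨ cong (λ m → w (+ m) - w (+ (N ∸ j))) (ℕP.+-∸-assoc 1 i≤N) ⟩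
    w (+ suc (N ∸ i)) - w (+ (N ∸ j))
      ∎)
    where
    open ≡-Reasoning
    S : ℤ
    S = + suc N
    cancel : ∀ S a b → (S - a) - (S - b) ≡ b - a
    cancel = solve-∀

  inRange-j<N : ∀ {i j} → InRange n i j → suc j ≤ N
  inRange-j<N (_ , _ , j≤N-1) = s≤s j≤N-1

  inRange-i≤N : ∀ {i j} → InRange n i j → i ≤ N
  inRange-i≤N range@(_ , i≤j , _) = ℕP.≤-trans i≤j (ℕP.<⇒≤ (inRange-j<N range))

  ReflectionInvariant : (ℤ → ℤ) → Set
  ReflectionInvariant w = ∀ i → 1 ≤ i → i ≤ N → reflect N w (+ i) ≡ w (+ i)

  reflectionInvariant⇒selfConjugate : ∀ w → ReflectionInvariant w → SelfConjugate n (T n w)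
  reflectionInvariant⇒selfConjugate w invariant i j range@(1≤i , _ , _) = begin
    T n w i j                ≡⟨ T-determined-by-difference (reflect N w) i j w i j
                                  (cong₂ _-_ (invariant (suc j) (s≤s z≤n) (inRange-j<N range))
                                             (invariant i 1≤i (inRange-i≤N range))) ⟨
    T n (reflect N w) i j    ≡⟨ T-reflect w (inRange-i≤N range) (ℕP.<⇒≤ (inRange-j<N range)) ⟩
    T n w (N ∸ j) (N ∸ i)    ∎
    where open ≡-Reasoning

  selfConjugate⇒sameTableau : ∀ w → SelfConjugate n (T n w) → TabEq n (T n w) (T n (reflect N w))
  selfConjugate⇒sameTableau w self-conjugate i j range =
    trans (self-conjugate i j range) (sym (T-reflect w (inRange-i≤N range) (ℕP.<⇒≤ (inRange-j<N range))))

  complement-in-window : ∀ {i} → 1 ≤ i → i ≤ N → 1 ≤ suc N ∸ i × suc N ∸ i ≤ N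
  complement-in-window 1≤i i≤N = ℕP.m<n⇒0<n∸m (s≤s i≤N) , ℕP.∸-monoʳ-≤ (suc N) 1≤i

  reflectionInvariant⇒antisymmetric : ∀ w → Injective _≡_ _≡_ w → Periodic N w →
                                      ReflectionInvariant w → AntisymLevels n w
  reflectionInvariant⇒antisymmetric w injective periodic invariant i j 1≤i i≤N 1≤j j≤N rᵢ+rⱼ≡ = begin
    ℓ n w i          ≡⟨ ℤP.neg-involutive (ℓ n w i) ⟨
    - - ℓ n w i      ≡⟨ cong -_ (proj₂ base-level-at-i′) ⟨
    - ℓ n w i′       ≡⟨ cong (λ m → - ℓ n w m) i′≡j ⟩
    - ℓ n w j        ∎
    where
    open ≡-Reasoning
    S : ℤ
    S = + suc N
    i′ : ℕ
    i′ = suc N ∸ i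
    i′-in-window : 1 ≤ i′ × i′ ≤ N
    i′-in-window = complement-in-window 1≤i i≤N
    rᵢ≤N+1 : r n w i ≤ suc N
    rᵢ≤N+1 = ℕP.m≤n⇒m≤1+n (base≤N (w (+ i)))
    S-rᵢ≡rⱼ : S - + r n w i ≡ + r n w j
    S-rᵢ≡rⱼ = trans (sym (pos-∸ rᵢ≤N+1))
                    (cong +_ (trans (cong (_∸ r n w i) (trans (ℕP.+-comm 1 N) (sym rᵢ+rⱼ≡)))
                                    (ℕP.m+n∸m≡n (r n w i) (r n w j))))
    regroup : ∀ S r ℓ c → S - (r + ℓ * c) ≡ (S - r) + - ℓ * c
    regroup = solve-∀
    wi′≡ : w (+ i′) ≡ + r n w j + - ℓ n w i * + N
    wi′≡ = begin
      w (+ i′)                                ≡⟨ invariant i′ (proj₁ i′-in-window) (proj₂ i′-in-window) ⟨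
      reflect N w (+ i′)                      ≡⟨ reflect-window w (ℕP.m∸n≤m (suc N) i) ⟩
      S - w (+ (suc N ∸ i′))                  ≡⟨ cong (λ m → S - w (+ m)) (ℕP.m∸[m∸n]≡n (ℕP.m≤n⇒m≤1+n i≤N)) ⟩
      S - w (+ i)                             ≡⟨ cong (λ y → S - y) (base-level (w (+ i))) ⟩
      S - (+ r n w i + ℓ n w i * + N)         ≡⟨ regroup S (+ r n w i) (ℓ n w i) (+ N) ⟩
      (S - + r n w i) + - ℓ n w i * + N       ≡⟨ cong (_+ - ℓ n w i * + N) S-rᵢ≡rⱼ ⟩
      + r n w j + - ℓ n w i * + N             ∎
    base-level-at-i′ : r n w i′ ≡ r n w j × ℓ n w i′ ≡ - ℓ n w i
    base-level-at-i′ = base-level-unique wi′≡ (s≤s z≤n) (base≤N (w (+ j)))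
    i′≡j : i′ ≡ j
    i′≡j = window-bases-distinct injective periodic (proj₁ i′-in-window) (proj₂ i′-in-window) 1≤j j≤N
             (proj₁ base-level-at-i′)

  reflected-value-attained : ∀ w → Surjective _≡_ _≡_ w → Periodic N w → AntisymLevels n w →
                             ∀ i → 1 ≤ i → i ≤ N → ∃ λ j → 1 ≤ j × j ≤ N × w (+ j) ≡ + suc N - w (+ i)
  reflected-value-attained w surjective periodic antisymmetric i 1≤i i≤N = j , s≤s z≤n , base≤N x , wj≡
    where
    open ≡-Reasoning
    S : ℤ
    S = + suc N
    rᵢ≤N+1 : r n w i ≤ suc N
    rᵢ≤N+1 = ℕP.m≤n⇒m≤1+n (base≤N (w (+ i)))
    c : ℕ
    c = suc N ∸ r n w i
    c-in-window : 1 ≤ c × c ≤ N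
    c-in-window = complement-in-window (s≤s z≤n) (base≤N (w (+ i)))
    x : ℤ
    x = proj₁ (surjective (+ c))
    j : ℕ
    j = base n x
    p : ℤ
    p = level n x
    cancel : ∀ a p c → a ≡ a + p * c + - p * c
    cancel = solve-∀
    wj≡c-pN : w (+ j) ≡ + c + - p * + N
    wj≡c-pN = begin
      w (+ j)                           ≡⟨ cancel (w (+ j)) p (+ N) ⟩
      w (+ j) + p * + N + - p * + N     ≡⟨ cong (_+ - p * + N) (periodic-base-level w periodic x) ⟨
      w x + - p * + N                   ≡⟨ cong (_+ - p * + N) (proj₂ (surjective (+ c)) refl) ⟩
      + c + - p * + N                   ∎
    base-level-at-j : r n w j ≡ c × ℓ n w j ≡ - p
    base-level-at-j = base-level-unique wj≡c-pN (proj₁ c-in-window) (proj₂ c-in-window)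
    rᵢ+rⱼ≡ : r n w i ℕ.+ r n w j ≡ N ℕ.+ 1
    rᵢ+rⱼ≡ = trans (cong (r n w i ℕ.+_) (proj₁ base-level-at-j))
                   (trans (ℕP.m+[n∸m]≡n rᵢ≤N+1) (ℕP.+-comm 1 N))
    ℓᵢ≡p : ℓ n w i ≡ p
    ℓᵢ≡p = trans (antisymmetric i j 1≤i i≤N (s≤s z≤n) (base≤N x) rᵢ+rⱼ≡)
                 (trans (cong -_ (proj₂ base-level-at-j)) (ℤP.neg-involutive p))
    regroup : ∀ S r ℓ c → (S - r) + - ℓ * c ≡ S - (r + ℓ * c)
    regroup = solve-∀
    wj≡ : w (+ j) ≡ S - w (+ i)
    wj≡ = begin
      w (+ j)                                 ≡⟨ wj≡c-pN ⟩
      + c + - p * + N                         ≡⟨ cong₂ (λ a q → a + - q * + N) (pos-∸ rᵢ≤N+1) (sym ℓᵢ≡p) ⟩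
      (S - + r n w i) + - ℓ n w i * + N       ≡⟨ regroup S (+ r n w i) (ℓ n w i) (+ N) ⟩
      S - (+ r n w i + ℓ n w i * + N)         ≡⟨ cong (λ y → S - y) (base-level (w (+ i))) ⟨
      S - w (+ i)                             ∎

  antisymmetric⇒reflectionInvariant : ∀ w → Surjective _≡_ _≡_ w → Periodic N w →
                                      StrictlyIncreasing N (λ i → w (+ i)) → AntisymLevels n w →
                                      ReflectionInvariant w
  antisymmetric⇒reflectionInvariant w surjective periodic increasing antisymmetric i 1≤i i≤N =
    ℤP.≤-antisym (increasing-⊆⇒≤ increasing reflect-increasing w⊆reflect i 1≤i i≤N)
                 (increasing-⊆⇒≤ reflect-increasing increasing reflect⊆w i 1≤i i≤N)
    where
    S : ℤ
    S = + suc N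
    attained : ∀ i → 1 ≤ i → i ≤ N → ∃ λ j → 1 ≤ j × j ≤ N × w (+ j) ≡ S - w (+ i)
    attained = reflected-value-attained w surjective periodic antisymmetric
    reflect-increasing : StrictlyIncreasing N (λ i → reflect N w (+ i))
    reflect-increasing i 1≤i i<N =
      subst₂ _<ℤ_ (sym (reflect-window w (ℕP.m≤n⇒m≤1+n (ℕP.<⇒≤ i<N)))) (sym (reflect-window w (ℕP.m≤n⇒m≤1+n i<N)))
        (ℤP.+-monoʳ-< S (ℤP.neg-mono-<
          (subst (λ m → w (+ (N ∸ i)) <ℤ w (+ m)) (sym (ℕP.+-∸-assoc 1 (ℕP.<⇒≤ i<N)))
            (increasing (N ∸ i) (ℕP.m<n⇒0<n∸m i<N) (ℕP.∸-monoʳ-< {o = 0} 1≤i (ℕP.<⇒≤ i<N))))))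
    w⊆reflect : ∀ i → 1 ≤ i → i ≤ N → ∃ λ j → 1 ≤ j × j ≤ N × reflect N w (+ j) ≡ w (+ i)
    w⊆reflect i 1≤i i≤N with attained i 1≤i i≤N
    ... | j , 1≤j , j≤N , wj≡ = suc N ∸ j , proj₁ j′-in-window , proj₂ j′-in-window , (begin
      reflect N w (+ (suc N ∸ j))        ≡⟨ reflect-window w (ℕP.m∸n≤m (suc N) j) ⟩
      S - w (+ (suc N ∸ (suc N ∸ j)))    ≡⟨ cong (λ m → S - w (+ m)) (ℕP.m∸[m∸n]≡n (ℕP.m≤n⇒m≤1+n j≤N)) ⟩
      S - w (+ j)                        ≡⟨ cong (λ y → S - y) wj≡ ⟩
      S - (S - w (+ i))                  ≡⟨ twice S (w (+ i)) ⟩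
      w (+ i)                            ∎)
      where
      open ≡-Reasoning
      j′-in-window : 1 ≤ suc N ∸ j × suc N ∸ j ≤ N
      j′-in-window = complement-in-window 1≤j j≤N
      twice : ∀ S a → S - (S - a) ≡ a
      twice = solve-∀
    reflect⊆w : ∀ i → 1 ≤ i → i ≤ N → ∃ λ j → 1 ≤ j × j ≤ N × w (+ j) ≡ reflect N w (+ i)
    reflect⊆w i 1≤i i≤N with complement-in-window 1≤i i≤N
    ... | 1≤i′ , i′≤N with attained (suc N ∸ i) 1≤i′ i′≤N
    ...   | j , 1≤j , j≤N , wj≡ = j , 1≤j , j≤N , trans wj≡ (sym (reflect-window w (ℕP.m≤n⇒m≤1+n i≤N)))

  selfConjugate⇒reflectionInvariant : ∀ w → InM n w → SelfConjugate n (T n w) → ReflectionInvariant w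
  selfConjugate⇒reflectionInvariant w (((injective , surjective) , periodic , sum≡) , _) self-conjugate i _ _ =
    sym (tableau-injective {w} {reflect N w} periodic (reflect-injective {N} w injective) (reflect-periodic w periodic)
           (selfConjugate⇒sameTableau w self-conjugate) injective surjective same-sum (+ i))
    where
    open ≡-Reasoning
    B : ℕ
    B = (N ℕ.+ 1) C 2
    cancel : ∀ b → (b + b) - b ≡ b
    cancel = solve-∀
    same-sum : sumFrom1 N (λ i → reflect N w (+ i)) ≡ sumFrom1 N (λ i → w (+ i))
    same-sum = begin
      sumFrom1 N (λ i → reflect N w (+ i))         ≡⟨ reflect-sum {N} w ⟩
      + N * + suc N - sumFrom1 N (λ i → w (+ i))   ≡⟨ cong₂ _-_ (trans (sym (ℤP.pos-* N (suc N)))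
                                                                       (cong +_ (sym ([m+1]C2+[m+1]C2≡m*[1+m] N)))) sum≡ ⟩
      (+ B + + B) - + B                            ≡⟨ cancel (+ B) ⟩
      + B                                          ≡⟨ sum≡ ⟨
      sumFrom1 N (λ i → w (+ i))                   ∎

  conjugate-inRange : ∀ {i j} → InRange n i j → InRange n (N ∸ j) (N ∸ i)
  conjugate-inRange {i} {j} (1≤i , i≤j , j≤N-1) =
    ℕP.m<n⇒0<n∸m (s≤s j≤N-1) , ℕP.∸-monoʳ-≤ N i≤j , ℕP.∸-monoʳ-≤ N 1≤i

  selfConjugate-resp-TabEq : ∀ {s t} → TabEq n s t → SelfConjugate n t → SelfConjugate n s
  selfConjugate-resp-TabEq s≈t self-conjugate i j range =
    trans (s≈t i j range) (trans (self-conjugate i j range) (sym (s≈t (N ∸ j) (N ∸ i) (conjugate-inRange range))))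

proposition2p6 : (n : ℕ) → 1 ≤ n →
    -- 𝖳 maps antisymmetric elements of M(A_{2n-1}) to self-conjugate Shi tableaux
    ((w : ℤ → ℤ) → InM n w → AntisymLevels n w →
       IsShiTableau n (T n w) × SelfConjugate n (T n w))
    -- injectivity of the restriction
    × ((w w′ : ℤ → ℤ) → InM n w → AntisymLevels n w → InM n w′ → AntisymLevels n w′ →
       TabEq n (T n w) (T n w′) → (x : ℤ) → w x ≡ w′ x)
    -- surjectivity onto self-conjugate Shi tableaux
    × ((t : Tableau) → IsShiTableau n t → SelfConjugate n t →
       ∃ λ w → InM n w × AntisymLevels n w × TabEq n (T n w) t)
proposition2p6 (suc k) _ = maps-into , injective , surjective
  where
  open Abacus k
  maps-into : (w : ℤ → ℤ) → InM n w → AntisymLevels n w → IsShiTableau n (T n w) × SelfConjugate n (T n w)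
  maps-into w inM@(((_ , surj) , periodic , _) , increasing) antisymmetric =
    (w , inM , λ _ _ _ → refl) ,
    reflectionInvariant⇒selfConjugate w (antisymmetric⇒reflectionInvariant w surj periodic increasing antisymmetric)
  -- 𝖳 is injective on all of M(A_{2n-1}).
  injective : (w w′ : ℤ → ℤ) → InM n w → AntisymLevels n w → InM n w′ → AntisymLevels n w′ →
              TabEq n (T n w) (T n w′) → (x : ℤ) → w x ≡ w′ x
  injective w w′ (((inj , surj) , periodic , sum≡) , _) _ (((inj′ , _) , periodic′ , sum≡′) , _) _ same-tableau =
    tableau-injective {w} {w′} periodic inj′ periodic′ same-tableau inj surj (trans sum≡′ (sym sum≡))
  surjective : (t : Tableau) → IsShiTableau n t → SelfConjugate n t →
               ∃ λ w → InM n w × AntisymLevels n w × TabEq n (T n w) t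
  surjective t (w , inM@(((inj , _) , periodic , _) , _) , T≈t) self-conjugate =
    w , inM ,
    reflectionInvariant⇒antisymmetric w inj periodic
      (selfConjugate⇒reflectionInvariant w inM (selfConjugate-resp-TabEq T≈t self-conjugate)) ,
    T≈t
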